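{- Let $q\in\mathbb{C}$ with $0<|q|<1$ and $a,b\in\mathbb{C}$. Let $B_{n,k}(a,b)$ ($n\ge k\ge0$) be the unique complex numbers such that for every integer $k\ge0$, $$z^k=\sum_{n=k}^\infty B_{n,k}(a,b)\,z^n\frac{(az;q)_n}{(bz;q)_n}\quad\text{in }\mathbb{C}[[z]],$$ and set $B_{n,k}(a,b)=0$ for $n<k$. Then for all integers $k\ge0$ and $n\ge1$, $$B_{n,k+1}(a,b)+(b-a)\sum_{i=k+2}^{n}b^{\,i-k-2}B_{n,i}(a,b)=q^{\,n-k-1}B_{n-1,k}(a,b),$$ where the sum is $0$ when $k+2>n$ and $b^0:=1$.
   Context: $(x;q)_n=\prod_{i=0}^{n-1}(1-xq^i)$ for $n\ge0$, with $(x;q)_0=1$; quotients $(az;q)_n/(bz;q)_n$ are expanded as formal power series in $z$. -}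

module Defs where

open import Algebra.Bundles using (CommutativeRing)
open import Data.Nat as ℕ using (ℕ; zero; suc; _∸_; _<_)
open import Data.Product using (_×_)
open import Relation.Nullary using (does)
open import Data.Bool using (if_then_else_)
import Level

module QSeries {c ℓ} (R : CommutativeRing c ℓ) where
  open CommutativeRing R

  Series : Set c
  Series = ℕ → Carrier

  pow : Carrier → ℕ → Carrier
  pow x zero    = 1#
  pow x (suc n) = x * pow x n

  Σ< : ℕ → (ℕ → Carrier) → Carrier
  Σ< zero    f = 0#
  Σ< (suc n) f = Σ< n f + f n

  -- ΣFromTo m n f = Σ_{i=m}^{n} f i  (0 when m > n)
  ΣFromTo : ℕ → ℕ → (ℕ → Carrier) → Carrier
  ΣFromTo m n f = Σ< (suc n ∸ m) (λ j → f (m ℕ.+ j))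

  _⊛_ : Series → Series → Series
  (f ⊛ g) m = Σ< (suc m) (λ i → f i * g (m ∸ i))

  one : Series
  one zero    = 1#
  one (suc _) = 0#

  lin : Carrier → Series
  lin x zero          = 1#
  lin x (suc zero)    = - x
  lin x (suc (suc _)) = 0#

  -- the series 1/(1 - x z) = Σ_j x^j z^j
  geom : Carrier → Series
  geom x j = pow x j

  pochNum : Carrier → Carrier → ℕ → Series
  pochNum a q zero    = one
  pochNum a q (suc n) = pochNum a q n ⊛ lin (a * pow q n)

  pochInvDen : Carrier → Carrier → ℕ → Series
  pochInvDen b q zero    = one
  pochInvDen b q (suc n) = pochInvDen b q n ⊛ geom (b * pow q n)

  pochQuot : Carrier → Carrier → Carrier → ℕ → Series
  pochQuot a b q n = pochNum a q n ⊛ pochInvDen b q n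

  shift : ℕ → Series → Series
  shift zero    s m       = s m
  shift (suc n) s zero    = 0#
  shift (suc n) s (suc m) = shift n s m

  δ : ℕ → ℕ → Carrier
  δ m k = if does (m ℕ.≟ k) then 1# else 0#

  -- B is the coefficient family B_{n,k}(a,b):
  --   z^k = Σ_{n≥k} B n k · z^n (az;q)_n/(bz;q)_n  in R[[z]]  for every k,
  --   compared coefficientwise (the coefficient of z^m only involves n ≤ m),
  -- and B n k = 0 for n < k.
  IsB : (q a b : Carrier) → (ℕ → ℕ → Carrier) → Set ℓ
  IsB q a b B =
    (∀ k m → ΣFromTo k m (λ n → B n k * shift n (pochQuot a b q n) m) ≈ δ m k)
    × (∀ n k → n < k → B n k ≈ 0#)

module Submission where

-- Write P_n(z) = (az;q)_n/(bz;q)_n and, for a family X = (X_n), let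
-- expand X = Σ_n X_n z^n P_n(z).  By hypothesis expand B(-,k) = z^k, and
-- expand is injective since z^n P_n(z) = z^n + (higher terms).  It therefore
-- suffices to show that both sides of the recurrence, as families in n, have
-- the same expansion, namely z^{k+1} R(z) with R(z) = (1-az)/(1-bz).
--  * Left side: Horner's rule for the sum and  R = 1 + (b-a) z/(1-bz)  give
--    z^{k+1} + (b-a) z^{k+2}/(1-bz) = z^{k+1} R(z).
--  * Right side: P_{n+1}(z) = R(z) P_n(qz), so its expansion is
--    z R(z) Σ_n q^{n-k} B_{n,k} z^n P_n(qz), and the coefficient of z^j of this
--    last sum is q^{j-k} times that of expand B(-,k) = z^k, i.e. it is z^k.

open import Defs
open import Algebra.Bundles using (CommutativeRing; CommutativeMonoid)
open import Data.Nat as ℕ using (ℕ; suc; _∸_; _≤_)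
open import Data.Nat using (zero; _<_; s≤s)
import Data.Nat.Properties as NP
open import Data.Nat.Induction using (<-rec)
open import Data.Product using (_,_; proj₁; proj₂)
open import Relation.Nullary using (¬_; yes; no)
open import Relation.Binary.PropositionalEquality as P using (_≡_)
open import Relation.Binary.Bundles using (Setoid)
open import Data.Empty using (⊥-elim)
import Relation.Binary.Reasoning.Setoid as SetoidReasoning
import Algebra.Properties.Ring as RingProperties
import Algebra.Properties.Group as GroupProperties
import Algebra.Properties.CommutativeSemigroup as CommutativeSemigroupProperties
import Algebra.Properties.CommutativeSemiring.Exp as ExpProperties

module FormalSeries {c ℓ} (R : CommutativeRing c ℓ) where
  open CommutativeRing R
  open QSeries R
  open SetoidReasoning setoid
  open RingProperties ring using (-‿distribˡ-*)
  open GroupProperties +-group using () renaming (∙-cancelˡ to +-cancelˡ) public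
  open CommutativeSemigroupProperties +-commutativeSemigroup using ()
    renaming (interchange to +-interchange)
  open CommutativeSemigroupProperties *-commutativeSemigroup using (x∙yz≈y∙xz)
    renaming (interchange to *-interchange) public
  open ExpProperties commutativeSemiring using (_^_; ^-congˡ; ^-homo-*; ^-distrib-*)

  pow≡^ : ∀ x n → pow x n ≡ x ^ n
  pow≡^ x zero    = P.refl
  pow≡^ x (suc n) = P.cong (x *_) (pow≡^ x n)

  pow-cong : ∀ {x y} n → x ≈ y → pow x n ≈ pow y n
  pow-cong {x} {y} n x≈y = begin
    pow x n  ≡⟨ pow≡^ x n ⟩
    x ^ n    ≈⟨ ^-congˡ n x≈y ⟩
    y ^ n    ≡⟨ P.sym (pow≡^ y n) ⟩
    pow y n  ∎

  pow-+ : ∀ x m n → pow x (m ℕ.+ n) ≈ pow x m * pow x n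
  pow-+ x m n = begin
    pow x (m ℕ.+ n)    ≡⟨ pow≡^ x (m ℕ.+ n) ⟩
    x ^ (m ℕ.+ n)      ≈⟨ ^-homo-* x m n ⟩
    x ^ m * x ^ n      ≡⟨ P.sym (P.cong₂ _*_ (pow≡^ x m) (pow≡^ x n)) ⟩
    pow x m * pow x n  ∎

  pow-distrib : ∀ x y n → pow (x * y) n ≈ pow x n * pow y n
  pow-distrib x y n = begin
    pow (x * y) n      ≡⟨ pow≡^ (x * y) n ⟩
    (x * y) ^ n        ≈⟨ ^-distrib-* x y n ⟩
    x ^ n * y ^ n      ≡⟨ P.sym (P.cong₂ _*_ (pow≡^ x n) (pow≡^ y n)) ⟩
    pow x n * pow y n  ∎

  Σ<-cong : ∀ n {f g} → (∀ i → i < n → f i ≈ g i) → Σ< n f ≈ Σ< n g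
  Σ<-cong zero    f≈g = refl
  Σ<-cong (suc n) f≈g =
    +-cong (Σ<-cong n (λ i i<n → f≈g i (NP.m<n⇒m<1+n i<n))) (f≈g n (NP.n<1+n n))

  Σ<-zero : ∀ n {f} → (∀ i → i < n → f i ≈ 0#) → Σ< n f ≈ 0#
  Σ<-zero zero    f≈0 = refl
  Σ<-zero (suc n) f≈0 = trans
    (+-cong (Σ<-zero n (λ i i<n → f≈0 i (NP.m<n⇒m<1+n i<n))) (f≈0 n (NP.n<1+n n)))
    (+-identityˡ 0#)

  Σ<-length : ∀ {n n'} f → n ≡ n' → Σ< n f ≈ Σ< n' f
  Σ<-length f P.refl = refl

  Σ<-+ : ∀ n f g → Σ< n (λ i → f i + g i) ≈ Σ< n f + Σ< n g
  Σ<-+ zero    f g = sym (+-identityˡ 0#)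
  Σ<-+ (suc n) f g = trans (+-congʳ (Σ<-+ n f g)) (+-interchange _ _ _ _)

  Σ<-*ˡ : ∀ n x f → x * Σ< n f ≈ Σ< n (λ i → x * f i)
  Σ<-*ˡ zero    x f = zeroʳ x
  Σ<-*ˡ (suc n) x f = trans (distribˡ x _ _) (+-congʳ (Σ<-*ˡ n x f))

  Σ<-*ʳ : ∀ n x f → Σ< n f * x ≈ Σ< n (λ i → f i * x)
  Σ<-*ʳ zero    x f = zeroˡ x
  Σ<-*ʳ (suc n) x f = trans (distribʳ x _ _) (+-congʳ (Σ<-*ʳ n x f))

  Σ<-head : ∀ n f → Σ< (suc n) f ≈ f 0 + Σ< n (λ i → f (suc i))
  Σ<-head zero    f = trans (+-identityˡ _) (sym (+-identityʳ _))
  Σ<-head (suc n) f = trans (+-congʳ (Σ<-head n f)) (+-assoc _ _ _)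

  Σ<-split : ∀ k N f → Σ< (k ℕ.+ N) f ≈ Σ< k f + Σ< N (λ t → f (k ℕ.+ t))
  Σ<-split k zero    f = trans (Σ<-length f (NP.+-identityʳ k)) (sym (+-identityʳ _))
  Σ<-split k (suc N) f = begin
    Σ< (k ℕ.+ suc N) f                                   ≈⟨ Σ<-length f (NP.+-suc k N) ⟩
    Σ< (k ℕ.+ N) f + f (k ℕ.+ N)                         ≈⟨ +-congʳ (Σ<-split k N f) ⟩
    (Σ< k f + Σ< N (λ t → f (k ℕ.+ t))) + f (k ℕ.+ N)    ≈⟨ +-assoc _ _ _ ⟩
    Σ< k f + Σ< (suc N) (λ t → f (k ℕ.+ t))              ∎

  Σ<-extend : ∀ {N N'} f → N ≤ N' → (∀ i → N ≤ i → i < N' → f i ≈ 0#) → Σ< N f ≈ Σ< N' f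
  Σ<-extend {N} {N'} f N≤N' vanish = begin
    Σ< N f                                      ≈⟨ sym (+-identityʳ _) ⟩
    Σ< N f + 0#                                 ≈⟨ +-congˡ (sym (Σ<-zero (N' ∸ N) tail≈0)) ⟩
    Σ< N f + Σ< (N' ∸ N) (λ t → f (N ℕ.+ t))    ≈⟨ sym (Σ<-split N (N' ∸ N) f) ⟩
    Σ< (N ℕ.+ (N' ∸ N)) f                       ≈⟨ Σ<-length f (NP.m+[n∸m]≡n N≤N') ⟩
    Σ< N' f                                     ∎
    where
    tail≈0 : ∀ t → t < N' ∸ N → f (N ℕ.+ t) ≈ 0#
    tail≈0 t t< = vanish (N ℕ.+ t) (NP.m≤m+n N t)
      (P.subst (N ℕ.+ t <_) (NP.m+[n∸m]≡n N≤N') (NP.+-monoʳ-< N t<))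

  Σ<-dropLeading : ∀ k m f → (∀ i → i < k → f i ≈ 0#) →
                   Σ< (suc m) f ≈ Σ< (suc m ∸ k) (λ j → f (k ℕ.+ j))
  Σ<-dropLeading k m f vanish with k NP.≤? suc m
  ... | yes k≤ = begin
    Σ< (suc m) f                                   ≈⟨ Σ<-length f (P.sym (NP.m+[n∸m]≡n k≤)) ⟩
    Σ< (k ℕ.+ (suc m ∸ k)) f                       ≈⟨ Σ<-split k _ f ⟩
    Σ< k f + Σ< (suc m ∸ k) (λ j → f (k ℕ.+ j))    ≈⟨ +-congʳ (Σ<-zero k vanish) ⟩
    0# + Σ< (suc m ∸ k) (λ j → f (k ℕ.+ j))        ≈⟨ +-identityˡ _ ⟩
    Σ< (suc m ∸ k) (λ j → f (k ℕ.+ j))             ∎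
  ... | no k≰ = begin
    Σ< (suc m) f                         ≈⟨ Σ<-zero (suc m) (λ i i< → vanish i (NP.<-trans i< m<k)) ⟩
    0#                                   ≈⟨ sym (Σ<-length _ (NP.m≤n⇒m∸n≡0 (NP.<⇒≤ m<k))) ⟩
    Σ< (suc m ∸ k) (λ j → f (k ℕ.+ j))   ∎
    where
    m<k : suc m < k
    m<k = NP.≰⇒> k≰

  Σ<-swap : ∀ N M (F : ℕ → ℕ → Carrier) →
            Σ< N (λ i → Σ< M (λ j → F i j)) ≈ Σ< M (λ j → Σ< N (λ i → F i j))
  Σ<-swap zero    M F = sym (Σ<-zero M (λ _ _ → refl))
  Σ<-swap (suc N) M F = trans (+-congʳ (Σ<-swap N M F)) (sym (Σ<-+ M _ _))

  Σ<-reverse : ∀ n f → Σ< n f ≈ Σ< n (λ i → f (n ∸ suc i))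
  Σ<-reverse zero    f = refl
  Σ<-reverse (suc n) f = begin
    Σ< n f + f n                        ≈⟨ +-congʳ (Σ<-reverse n f) ⟩
    Σ< n (λ i → f (n ∸ suc i)) + f n    ≈⟨ +-comm _ _ ⟩
    f n + Σ< n (λ i → f (n ∸ suc i))    ≈⟨ sym (Σ<-head n (λ i → f (n ∸ i))) ⟩
    Σ< (suc n) (λ i → f (n ∸ i))        ∎

  Σ<-triangle : ∀ N (F : ℕ → ℕ → Carrier) →
                Σ< N (λ i → Σ< (suc i) (λ j → F i j)) ≈ Σ< N (λ j → Σ< (N ∸ j) (λ t → F (j ℕ.+ t) j))
  Σ<-triangle zero    F = refl
  Σ<-triangle (suc N) F = begin
    Σ< N (λ i → Σ< (suc i) (λ j → F i j)) + Σ< (suc N) (F N)   ≈⟨ +-congʳ (Σ<-triangle N F) ⟩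
    Σ< N column + Σ< (suc N) (F N)                             ≈⟨ +-congʳ (Σ<-extend column (NP.n≤1+n N) last-column≈0) ⟩
    Σ< (suc N) column + Σ< (suc N) (F N)                       ≈⟨ sym (Σ<-+ (suc N) column (F N)) ⟩
    Σ< (suc N) (λ j → column j + F N j)                        ≈⟨ Σ<-cong (suc N) extend-column ⟩
    Σ< (suc N) (λ j → Σ< (suc N ∸ j) (λ t → F (j ℕ.+ t) j))    ∎
    where
    column : ℕ → Carrier
    column j = Σ< (N ∸ j) (λ t → F (j ℕ.+ t) j)
    last-column≈0 : ∀ j → N ≤ j → j < suc N → column j ≈ 0#
    last-column≈0 j N≤j _ = Σ<-zero (N ∸ j) (λ t t< → ⊥-elim (NP.n≮0 (P.subst (t <_) (NP.m≤n⇒m∸n≡0 N≤j) t<)))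
    extend-column : ∀ j → j < suc N → column j + F N j ≈ Σ< (suc N ∸ j) (λ t → F (j ℕ.+ t) j)
    extend-column j j< = begin
      column j + F N j                         ≈⟨ +-congˡ (reflexive (P.cong (λ i → F i j) (P.sym (NP.m+[n∸m]≡n (NP.≤-pred j<))))) ⟩
      Σ< (suc (N ∸ j)) (λ t → F (j ℕ.+ t) j)   ≈⟨ Σ<-length _ (P.sym (NP.+-∸-assoc 1 (NP.≤-pred j<))) ⟩
      Σ< (suc N ∸ j) (λ t → F (j ℕ.+ t) j)     ∎

  infix 4 _≗_
  _≗_ : Series → Series → Set ℓ
  f ≗ g = ∀ m → f m ≈ g m

  series-setoid : Setoid c ℓ
  series-setoid = record
    { Carrier       = Series
    ; _≈_           = _≗_
    ; isEquivalence = record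
      { refl  = λ _ → refl
      ; sym   = λ f≗g m → sym (f≗g m)
      ; trans = λ f≗g g≗h m → trans (f≗g m) (g≗h m) } }

  module ≗ = Setoid series-setoid
  module ≗-Reasoning = SetoidReasoning series-setoid

  ⊛-cong : ∀ {f f' g g'} → f ≗ f' → g ≗ g' → f ⊛ g ≗ f' ⊛ g'
  ⊛-cong f≗f' g≗g' m = Σ<-cong (suc m) (λ i _ → *-cong (f≗f' i) (g≗g' (m ∸ i)))

  ⊛-congˡ : ∀ f {g g'} → g ≗ g' → f ⊛ g ≗ f ⊛ g'
  ⊛-congˡ f = ⊛-cong {f} {f} ≗.refl

  ⊛-congʳ : ∀ {f f'} g → f ≗ f' → f ⊛ g ≗ f' ⊛ g
  ⊛-congʳ {f} {f'} g f≗f' = ⊛-cong {f} {f'} {g} {g} f≗f' ≗.refl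

  ⊛-comm : ∀ f g → f ⊛ g ≗ g ⊛ f
  ⊛-comm f g m = begin
    (f ⊛ g) m                                         ≈⟨ Σ<-reverse (suc m) (λ i → f i * g (m ∸ i)) ⟩
    Σ< (suc m) (λ i → f (m ∸ i) * g (m ∸ (m ∸ i)))    ≈⟨ Σ<-cong (suc m) swap-factors ⟩
    (g ⊛ f) m                                         ∎
    where
    swap-factors : ∀ i → i < suc m → f (m ∸ i) * g (m ∸ (m ∸ i)) ≈ g i * f (m ∸ i)
    swap-factors i i< = trans (*-congˡ (reflexive (P.cong g (NP.m∸[m∸n]≡n (NP.≤-pred i<))))) (*-comm _ _)

  ⊛-assoc : ∀ f g h → (f ⊛ g) ⊛ h ≗ f ⊛ (g ⊛ h)
  ⊛-assoc f g h m = begin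
    ((f ⊛ g) ⊛ h) m
      ≈⟨ Σ<-cong (suc m) (λ i _ → Σ<-*ʳ (suc i) (h (m ∸ i)) _) ⟩
    Σ< (suc m) (λ i → Σ< (suc i) (λ j → (f j * g (i ∸ j)) * h (m ∸ i)))
      ≈⟨ Σ<-triangle (suc m) (λ i j → (f j * g (i ∸ j)) * h (m ∸ i)) ⟩
    Σ< (suc m) (λ j → Σ< (suc m ∸ j) (λ t → (f j * g (j ℕ.+ t ∸ j)) * h (m ∸ (j ℕ.+ t))))
      ≈⟨ Σ<-cong (suc m) inner ⟩
    (f ⊛ (g ⊛ h)) m ∎
    where
    inner : ∀ j → j < suc m → Σ< (suc m ∸ j) (λ t → (f j * g (j ℕ.+ t ∸ j)) * h (m ∸ (j ℕ.+ t)))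
                              ≈ f j * (g ⊛ h) (m ∸ j)
    inner j j< = begin
      Σ< (suc m ∸ j) (λ t → (f j * g (j ℕ.+ t ∸ j)) * h (m ∸ (j ℕ.+ t)))
        ≈⟨ Σ<-length _ (NP.+-∸-assoc 1 (NP.≤-pred j<)) ⟩
      Σ< (suc (m ∸ j)) (λ t → (f j * g (j ℕ.+ t ∸ j)) * h (m ∸ (j ℕ.+ t)))
        ≈⟨ Σ<-cong (suc (m ∸ j)) (λ t _ → trans (*-assoc _ _ _) (*-congˡ (*-cong
             (reflexive (P.cong g (NP.m+n∸m≡n j t))) (reflexive (P.cong h (P.sym (NP.∸-+-assoc m j t))))))) ⟩
      Σ< (suc (m ∸ j)) (λ t → f j * (g t * h (m ∸ j ∸ t)))
        ≈⟨ sym (Σ<-*ˡ (suc (m ∸ j)) (f j) _) ⟩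
      f j * (g ⊛ h) (m ∸ j) ∎

  ⊛-identityʳ : ∀ f → f ⊛ one ≗ f
  ⊛-identityʳ f m = begin
    Σ< m (λ i → f i * one (m ∸ i)) + f m * one (m ∸ m)
      ≈⟨ +-cong (Σ<-zero m (λ i i< → trans (*-congˡ (one-pos (NP.m<n⇒0<n∸m i<))) (zeroʳ _)))
                (*-congˡ (reflexive (P.cong one (NP.n∸n≡0 m)))) ⟩
    0# + f m * 1#   ≈⟨ trans (+-identityˡ _) (*-identityʳ _) ⟩
    f m             ∎
    where
    one-pos : ∀ {n} → 0 < n → one n ≈ 0#
    one-pos {suc n} _ = refl

  ⊛-identityˡ : ∀ f → one ⊛ f ≗ f
  ⊛-identityˡ f = ≗.trans (⊛-comm one f) (⊛-identityʳ f)

  ⊛-commutativeMonoid : CommutativeMonoid c ℓ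
  ⊛-commutativeMonoid = record
    { Carrier = Series
    ; _≈_     = _≗_
    ; _∙_     = _⊛_
    ; ε       = one
    ; isCommutativeMonoid = record
      { isMonoid = record
        { isSemigroup = record
          { isMagma = record { isEquivalence = Setoid.isEquivalence series-setoid ; ∙-cong = ⊛-cong }
          ; assoc   = ⊛-assoc }
        ; identity = ⊛-identityˡ , ⊛-identityʳ }
      ; comm = ⊛-comm } }

  open CommutativeSemigroupProperties (CommutativeMonoid.commutativeSemigroup ⊛-commutativeMonoid)
    using () renaming (interchange to ⊛-interchange) public

  -- The substitution z ↦ x z, a homomorphism for the Cauchy product.

  scale : Carrier → Series → Series
  scale x s j = pow x j * s j

  scale-cong : ∀ x {s s'} → s ≗ s' → scale x s ≗ scale x s'
  scale-cong x s≗s' j = *-congˡ (s≗s' j)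

  scale-⊛ : ∀ x f g → scale x (f ⊛ g) ≗ scale x f ⊛ scale x g
  scale-⊛ x f g m = begin
    pow x m * (f ⊛ g) m                              ≈⟨ Σ<-*ˡ (suc m) (pow x m) _ ⟩
    Σ< (suc m) (λ i → pow x m * (f i * g (m ∸ i)))   ≈⟨ Σ<-cong (suc m) distribute ⟩
    (scale x f ⊛ scale x g) m                        ∎
    where
    distribute : ∀ i → i < suc m → pow x m * (f i * g (m ∸ i)) ≈ (pow x i * f i) * (pow x (m ∸ i) * g (m ∸ i))
    distribute i i< = begin
      pow x m * (f i * g (m ∸ i))
        ≈⟨ *-congʳ (trans (reflexive (P.cong (pow x) (P.sym (NP.m+[n∸m]≡n (NP.≤-pred i<))))) (pow-+ x i (m ∸ i))) ⟩
      (pow x i * pow x (m ∸ i)) * (f i * g (m ∸ i))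
        ≈⟨ *-interchange _ _ _ _ ⟩
      (pow x i * f i) * (pow x (m ∸ i) * g (m ∸ i)) ∎

  scale-one : ∀ x → scale x one ≗ one
  scale-one x zero    = *-identityˡ 1#
  scale-one x (suc m) = zeroʳ _

  scale-lin : ∀ x y → scale x (lin y) ≗ lin (y * x)
  scale-lin x y zero          = *-identityˡ 1#
  scale-lin x y (suc zero)    = begin
    (x * 1#) * (- y)  ≈⟨ *-congʳ (*-identityʳ x) ⟩
    x * (- y)         ≈⟨ *-comm x (- y) ⟩
    (- y) * x         ≈⟨ sym (-‿distribˡ-* y x) ⟩
    - (y * x)         ∎
  scale-lin x y (suc (suc m)) = zeroʳ _

  scale-geom : ∀ x y → scale x (geom y) ≗ geom (y * x)
  scale-geom x y j = trans (*-comm _ _) (sym (pow-distrib y x j))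

  lin-cong : ∀ {x y} → x ≈ y → lin x ≗ lin y
  lin-cong x≈y zero          = refl
  lin-cong x≈y (suc zero)    = -‿cong x≈y
  lin-cong x≈y (suc (suc m)) = refl

  geom-cong : ∀ {x y} → x ≈ y → geom x ≗ geom y
  geom-cong x≈y j = pow-cong j x≈y

  -- q-products.  If Π_n = Π_{i<n} E(y x^i) and E(u)(x z) = E(u x)(z), then
  -- Π_{n+1}(z) = E(y)(z) · Π_n(x z).  This covers both (az;q)_n and 1/(bz;q)_n.
  qProduct-unfold : (x : Carrier) (E : Carrier → Series) → (∀ {u v} → u ≈ v → E u ≗ E v) →
    (∀ u → scale x (E u) ≗ E (u * x)) → (y : Carrier) (Π : ℕ → Series) →
    Π 0 ≗ one → (∀ n → Π (suc n) ≗ Π n ⊛ E (y * pow x n)) →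
    ∀ n → Π (suc n) ≗ E y ⊛ scale x (Π n)
  qProduct-unfold x E E-cong E-scale y Π Π0 Πsuc zero = ≗-Reasoning.begin
    Π 1                  ≗-Reasoning.≈⟨ ≗.trans (Πsuc 0) (⊛-congʳ (E (y * 1#)) Π0) ⟩
    one ⊛ E (y * 1#)     ≗-Reasoning.≈⟨ ≗.trans (⊛-identityˡ _) (E-cong (*-identityʳ y)) ⟩
    E y                  ≗-Reasoning.≈⟨ ≗.sym (⊛-identityʳ _) ⟩
    E y ⊛ one            ≗-Reasoning.≈⟨ ⊛-congˡ (E y) (≗.sym (≗.trans (scale-cong x Π0) (scale-one x))) ⟩
    E y ⊛ scale x (Π 0)  ≗-Reasoning.∎
  qProduct-unfold x E E-cong E-scale y Π Π0 Πsuc (suc n) = ≗-Reasoning.begin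
    Π (suc (suc n))
      ≗-Reasoning.≈⟨ ≗.trans (Πsuc (suc n)) (⊛-congʳ (E (y * pow x (suc n)))
                       (qProduct-unfold x E E-cong E-scale y Π Π0 Πsuc n)) ⟩
    (E y ⊛ scale x (Π n)) ⊛ E (y * pow x (suc n))
      ≗-Reasoning.≈⟨ ⊛-assoc (E y) (scale x (Π n)) (E (y * pow x (suc n))) ⟩
    E y ⊛ (scale x (Π n) ⊛ E (y * pow x (suc n)))
      ≗-Reasoning.≈⟨ ⊛-congˡ (E y) (⊛-congˡ (scale x (Π n)) (≗.sym (≗.trans (E-scale (y * pow x n)) (E-cong yxⁿx≈yxⁿ⁺¹)))) ⟩
    E y ⊛ (scale x (Π n) ⊛ scale x (E (y * pow x n)))
      ≗-Reasoning.≈⟨ ⊛-congˡ (E y) (≗.sym (≗.trans (scale-cong x (Πsuc n)) (scale-⊛ x (Π n) (E (y * pow x n))))) ⟩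
    E y ⊛ scale x (Π (suc n)) ≗-Reasoning.∎
    where
    yxⁿx≈yxⁿ⁺¹ : (y * pow x n) * x ≈ y * pow x (suc n)
    yxⁿx≈yxⁿ⁺¹ = trans (*-assoc y _ x) (*-congˡ (*-comm _ x))

  shift-below : ∀ n s j → j < n → shift n s j ≈ 0#
  shift-below (suc n) s zero    _       = refl
  shift-below (suc n) s (suc j) (s≤s j<) = shift-below n s j j<

  shift-diagonal : ∀ n s → shift n s n ≈ s 0
  shift-diagonal zero    s = refl
  shift-diagonal (suc n) s = shift-diagonal n s

  shift-cong : ∀ n {s s'} → s ≗ s' → shift n s ≗ shift n s'
  shift-cong zero    s≗s' m       = s≗s' m
  shift-cong (suc n) s≗s' zero    = refl
  shift-cong (suc n) s≗s' (suc m) = shift-cong n s≗s' m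

  shift-scale : ∀ x n s j → shift n (scale x s) j ≈ pow x (j ∸ n) * shift n s j
  shift-scale x zero    s j       = refl
  shift-scale x (suc n) s zero    = sym (zeroʳ _)
  shift-scale x (suc n) s (suc j) = shift-scale x n s j

  shift-⊛ : ∀ n f g → shift n (f ⊛ g) ≗ f ⊛ shift n g
  shift-⊛ zero    f g m       = refl
  shift-⊛ (suc n) f g zero    = sym (trans (+-identityˡ _) (zeroʳ _))
  shift-⊛ (suc n) f g (suc m) = trans (shift-⊛ n f g m) shift-once
    where
    -- the extra last term of the longer convolution is f (m+1) · 0
    shift-once : (f ⊛ shift n g) m ≈ (f ⊛ shift (suc n) g) (suc m)
    shift-once = begin
      Σ< (suc m) (λ i → f i * shift n g (m ∸ i))
        ≈⟨ Σ<-cong (suc m) (λ i i< → *-congˡ (reflexive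
             (P.cong (shift (suc n) g) (P.sym (NP.+-∸-assoc 1 (NP.≤-pred i<)))))) ⟩
      Σ< (suc m) (λ i → f i * shift (suc n) g (suc m ∸ i))
        ≈⟨ sym (+-identityʳ _) ⟩
      Σ< (suc m) (λ i → f i * shift (suc n) g (suc m ∸ i)) + 0#
        ≈⟨ +-congˡ (sym (trans (*-congˡ (reflexive (P.cong (shift (suc n) g) (NP.n∸n≡0 m)))) (zeroʳ _))) ⟩
      (f ⊛ shift (suc n) g) (suc m) ∎

  -- A locally finite linear combination Σ_n c_n F_n (F_n divisible by z^n)
  -- commutes with multiplication by a fixed series G.
  Σ-⊛-distrib : ∀ G (c : ℕ → Carrier) (F : ℕ → Series) → (∀ n j → j < n → F n j ≈ 0#) → ∀ m →
    Σ< (suc m) (λ n → c n * (G ⊛ F n) m) ≈ (G ⊛ (λ j → Σ< (suc j) (λ n → c n * F n j))) m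
  Σ-⊛-distrib G c F F-low m = begin
    Σ< (suc m) (λ n → c n * (G ⊛ F n) m)
      ≈⟨ Σ<-cong (suc m) (λ n _ → Σ<-*ˡ (suc m) (c n) _) ⟩
    Σ< (suc m) (λ n → Σ< (suc m) (λ i → c n * (G i * F n (m ∸ i))))
      ≈⟨ Σ<-swap (suc m) (suc m) (λ n i → c n * (G i * F n (m ∸ i))) ⟩
    Σ< (suc m) (λ i → Σ< (suc m) (λ n → c n * (G i * F n (m ∸ i))))
      ≈⟨ Σ<-cong (suc m) (λ i _ → trans (Σ<-cong (suc m) (λ n _ → x∙yz≈y∙xz _ _ _)) (sym (Σ<-*ˡ (suc m) (G i) _))) ⟩
    Σ< (suc m) (λ i → G i * Σ< (suc m) (λ n → c n * F n (m ∸ i)))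
      ≈⟨ Σ<-cong (suc m) (λ i _ → *-congˡ (sym (truncate i))) ⟩
    (G ⊛ (λ j → Σ< (suc j) (λ n → c n * F n j))) m ∎
    where
    truncate : ∀ i → Σ< (suc (m ∸ i)) (λ n → c n * F n (m ∸ i)) ≈ Σ< (suc m) (λ n → c n * F n (m ∸ i))
    truncate i = Σ<-extend _ (s≤s (NP.m∸n≤m m i)) (λ n i< _ → trans (*-congˡ (F-low n (m ∸ i) i<)) (zeroʳ _))

  δ-≢ : ∀ m k → ¬ m ≡ k → δ m k ≈ 0#
  δ-≢ zero    zero    m≢k = ⊥-elim (m≢k P.refl)
  δ-≢ zero    (suc k) m≢k = refl
  δ-≢ (suc m) zero    m≢k = refl
  δ-≢ (suc m) (suc k) m≢k = δ-≢ m k (λ m≡k → m≢k (P.cong suc m≡k))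

  δ≈shift-one : ∀ k j → δ j k ≈ shift k one j
  δ≈shift-one zero    zero    = refl
  δ≈shift-one zero    (suc j) = refl
  δ≈shift-one (suc k) zero    = refl
  δ≈shift-one (suc k) (suc j) = δ≈shift-one k j

  shift-geom-unfold : ∀ y j m → shift j (geom y) m ≈ δ m j + y * shift (suc j) (geom y) m
  shift-geom-unfold y zero    zero    = sym (trans (+-congˡ (zeroʳ y)) (+-identityʳ 1#))
  shift-geom-unfold y zero    (suc m) = sym (+-identityˡ _)
  shift-geom-unfold y (suc j) zero    = sym (trans (+-identityˡ _) (zeroʳ y))
  shift-geom-unfold y (suc j) (suc m) = shift-geom-unfold y j m

  shift-partialFraction : ∀ x y k m →
    shift k (lin x ⊛ geom y) m ≈ δ m k + (y - x) * shift (suc k) (geom y) m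
  shift-partialFraction x y zero    zero    = trans coefficient-0 (sym (trans (+-congˡ (zeroʳ _)) (+-identityʳ _)))
    where
    coefficient-0 : (lin x ⊛ geom y) 0 ≈ 1#
    coefficient-0 = trans (+-identityˡ _) (*-identityˡ 1#)
  shift-partialFraction x y zero    (suc m) = trans coefficient-suc (sym (+-identityˡ _))
    where
    coefficient-suc : (lin x ⊛ geom y) (suc m) ≈ (y - x) * pow y m
    coefficient-suc = begin
      (lin x ⊛ geom y) (suc m)
        ≈⟨ Σ<-head (suc m) _ ⟩
      1# * (y * pow y m) + Σ< (suc m) (λ i → lin x (suc i) * pow y (m ∸ i))
        ≈⟨ +-congˡ (Σ<-head m _) ⟩
      1# * (y * pow y m) + ((- x) * pow y m + Σ< m (λ i → 0# * pow y (m ∸ suc i)))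
        ≈⟨ +-cong (*-identityˡ _) (trans (+-congˡ (Σ<-zero m (λ i _ → zeroˡ _))) (+-identityʳ _)) ⟩
      y * pow y m + (- x) * pow y m
        ≈⟨ sym (distribʳ _ _ _) ⟩
      (y - x) * pow y m ∎
  shift-partialFraction x y (suc k) zero    = sym (trans (+-identityˡ _) (zeroʳ _))
  shift-partialFraction x y (suc k) (suc m) = shift-partialFraction x y k m

module Expansion {c ℓ} (R : CommutativeRing c ℓ) (q a b : CommutativeRing.Carrier R)
                 (B : ℕ → ℕ → CommutativeRing.Carrier R) (isB : QSeries.IsB R q a b B) where
  open CommutativeRing R
  open QSeries R
  open FormalSeries R
  open SetoidReasoning setoid

  P : ℕ → Series
  P = pochQuot a b q

  ratio : Series
  ratio = lin a ⊛ geom b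

  P-unfold : ∀ n → P (suc n) ≗ ratio ⊛ scale q (P n)
  P-unfold n = ≗-Reasoning.begin
    pochNum a q (suc n) ⊛ pochInvDen b q (suc n)
      ≗-Reasoning.≈⟨ ⊛-cong {pochNum a q (suc n)} {lin a ⊛ scale q Num} {pochInvDen b q (suc n)}
                       {geom b ⊛ scale q InvDen} (numerator n) (denominator n) ⟩
    (lin a ⊛ scale q Num) ⊛ (geom b ⊛ scale q InvDen)
      ≗-Reasoning.≈⟨ ⊛-interchange (lin a) (scale q Num) (geom b) (scale q InvDen) ⟩
    ratio ⊛ (scale q Num ⊛ scale q InvDen)
      ≗-Reasoning.≈⟨ ⊛-congˡ ratio (≗.sym (scale-⊛ q Num InvDen)) ⟩
    ratio ⊛ scale q (P n) ≗-Reasoning.∎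
    where
    Num InvDen : Series
    Num    = pochNum a q n
    InvDen = pochInvDen b q n
    numerator : ∀ n → pochNum a q (suc n) ≗ lin a ⊛ scale q (pochNum a q n)
    numerator = qProduct-unfold q lin lin-cong (scale-lin q) a (pochNum a q) ≗.refl (λ _ → ≗.refl)
    denominator : ∀ n → pochInvDen b q (suc n) ≗ geom b ⊛ scale q (pochInvDen b q n)
    denominator = qProduct-unfold q geom geom-cong (scale-geom q) b (pochInvDen b q) ≗.refl (λ _ → ≗.refl)

  P-constant : ∀ n → P n 0 ≈ 1#
  P-constant n = trans (+-identityˡ _) (trans (*-cong (numerator n) (denominator n)) (*-identityˡ 1#))
    where
    numerator : ∀ n → pochNum a q n 0 ≈ 1#
    numerator zero    = refl
    numerator (suc n) = trans (+-identityˡ _) (trans (*-identityʳ _) (numerator n))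
    denominator : ∀ n → pochInvDen b q n 0 ≈ 1#
    denominator zero    = refl
    denominator (suc n) = trans (+-identityˡ _) (trans (*-identityʳ _) (denominator n))

  expand : (ℕ → Carrier) → Series
  expand X m = Σ< (suc m) (λ n → X n * shift n (P n) m)

  expand-cong : ∀ {X Y} → (∀ n → X n ≈ Y n) → expand X ≗ expand Y
  expand-cong X≈Y m = Σ<-cong (suc m) (λ n _ → *-congʳ (X≈Y n))

  expand-+ : ∀ X Y m → expand (λ n → X n + Y n) m ≈ expand X m + expand Y m
  expand-+ X Y m = trans (Σ<-cong (suc m) (λ n _ → distribʳ _ _ _)) (Σ<-+ (suc m) _ _)

  expand-* : ∀ x X m → expand (λ n → x * X n) m ≈ x * expand X m
  expand-* x X m = trans (Σ<-cong (suc m) (λ n _ → *-assoc _ _ _)) (sym (Σ<-*ˡ (suc m) x _))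

  -- expand is injective: the coefficient of z^n of expand X is X_n plus a
  -- combination of X_0, …, X_{n-1}, so X is determined by strong induction.
  expand-injective : ∀ X Y → expand X ≗ expand Y → ∀ n → X n ≈ Y n
  expand-injective X Y X≗Y = <-rec (λ n → X n ≈ Y n) step
    where
    step : ∀ n → (∀ {i} → i < n → X i ≈ Y i) → X n ≈ Y n
    step n earlier = begin
      X n                        ≈⟨ sym (trans (*-congˡ diagonal) (*-identityʳ _)) ⟩
      X n * shift n (P n) n      ≈⟨ +-cancelˡ _ _ _ (trans (+-congʳ (sym lower)) (X≗Y n)) ⟩
      Y n * shift n (P n) n      ≈⟨ trans (*-congˡ diagonal) (*-identityʳ _) ⟩
      Y n                        ∎
      where
      diagonal : shift n (P n) n ≈ 1#
      diagonal = trans (shift-diagonal n (P n)) (P-constant n)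
      lower : Σ< n (λ i → X i * shift i (P i) n) ≈ Σ< n (λ i → Y i * shift i (P i) n)
      lower = Σ<-cong n (λ i i<n → *-congʳ (earlier i<n))

  expand-B : ∀ k m → expand (λ n → B n k) m ≈ δ m k
  expand-B k m = trans (Σ<-dropLeading k m _ below-k) (proj₁ isB k m)
    where
    below-k : ∀ n → n < k → B n k * shift n (P n) m ≈ 0#
    below-k n n<k = trans (*-congʳ (proj₂ isB n k n<k)) (zeroˡ _)

  tail : ℕ → ℕ → Carrier
  tail j n = ΣFromTo j n (λ i → pow b (i ∸ j) * B n i)

  tail-step : ∀ j n → tail j n ≈ B n j + b * tail (suc j) n
  tail-step j n with j NP.≤? n
  ... | yes j≤n = begin
    Σ< (suc n ∸ j) term                         ≈⟨ Σ<-length term (NP.+-∸-assoc 1 j≤n) ⟩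
    Σ< (suc (n ∸ j)) term                       ≈⟨ Σ<-head (n ∸ j) term ⟩
    term 0 + Σ< (n ∸ j) (λ t → term (suc t))    ≈⟨ +-cong term-0 (Σ<-cong (n ∸ j) (λ t _ → term-suc t)) ⟩
    B n j + Σ< (n ∸ j) (λ t → b * next t)       ≈⟨ +-congˡ (sym (Σ<-*ˡ (n ∸ j) b next)) ⟩
    B n j + b * tail (suc j) n                  ∎
    where
    term next : ℕ → Carrier
    term t = pow b (j ℕ.+ t ∸ j) * B n (j ℕ.+ t)
    next t = pow b (j ℕ.+ t ∸ j) * B n (suc (j ℕ.+ t))
    term-0 : term 0 ≈ B n j
    term-0 = begin
      pow b (j ℕ.+ 0 ∸ j) * B n (j ℕ.+ 0)  ≡⟨ P.cong (λ t → pow b (t ∸ j) * B n t) (NP.+-identityʳ j) ⟩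
      pow b (j ∸ j) * B n j                ≡⟨ P.cong (λ e → pow b e * B n j) (NP.n∸n≡0 j) ⟩
      1# * B n j                           ≈⟨ *-identityˡ _ ⟩
      B n j                                ∎
    term-suc : ∀ t → term (suc t) ≈ b * next t
    term-suc t = begin
      pow b (j ℕ.+ suc t ∸ j) * B n (j ℕ.+ suc t)
        ≡⟨ P.cong₂ (λ e i → pow b e * B n i) (NP.m+n∸m≡n j (suc t)) (NP.+-suc j t) ⟩
      (b * pow b t) * B n (suc (j ℕ.+ t))
        ≈⟨ *-assoc _ _ _ ⟩
      b * (pow b t * B n (suc (j ℕ.+ t)))
        ≡⟨ P.cong (λ e → b * (pow b e * B n (suc (j ℕ.+ t)))) (P.sym (NP.m+n∸m≡n j t)) ⟩
      b * next t ∎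
  ... | no j≰n = begin
    Σ< (suc n ∸ j) _              ≈⟨ Σ<-length _ (NP.m≤n⇒m∸n≡0 n<j) ⟩
    0#                            ≈⟨ sym (trans (+-cong (proj₂ isB n j n<j) (zeroʳ b)) (+-identityˡ 0#)) ⟩
    B n j + b * 0#                ≈⟨ +-congˡ (*-congˡ (sym (Σ<-length _ (NP.m≤n⇒m∸n≡0 (NP.<⇒≤ n<j))))) ⟩
    B n j + b * tail (suc j) n    ∎
    where
    n<j : n < j
    n<j = NP.≰⇒> j≰n

  expand-tail : ∀ j → expand (tail j) ≗ shift j (geom b)
  expand-tail j m = bounded (suc m) j m (s≤s (NP.m≤m+n m j))
    where
    -- induction on the distance d from j to beyond m
    bounded : ∀ d j m → m < d ℕ.+ j → expand (tail j) m ≈ shift j (geom b) m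
    bounded zero    j m m<j = begin
      expand (tail j) m         ≈⟨ Σ<-zero (suc m) (λ n n≤m → trans (*-congʳ (empty n n≤m)) (zeroˡ _)) ⟩
      0#                        ≈⟨ sym (shift-below j (geom b) m m<j) ⟩
      shift j (geom b) m        ∎
      where
      empty : ∀ n → n < suc m → tail j n ≈ 0#
      empty n n≤m = Σ<-length _ (NP.m≤n⇒m∸n≡0 (NP.≤-trans n≤m m<j))
    bounded (suc d) j m m<d+j = begin
      expand (tail j) m
        ≈⟨ expand-cong (tail-step j) m ⟩
      expand (λ n → B n j + b * tail (suc j) n) m
        ≈⟨ trans (expand-+ _ _ m) (+-cong (expand-B j m) (expand-* b (tail (suc j)) m)) ⟩
      δ m j + b * expand (tail (suc j)) m
        ≈⟨ +-congˡ (*-congˡ (bounded d (suc j) m (P.subst (m <_) (P.sym (NP.+-suc d j)) m<d+j))) ⟩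
      δ m j + b * shift (suc j) (geom b) m
        ≈⟨ sym (shift-geom-unfold b j m) ⟩
      shift j (geom b) m ∎

  lhs : ℕ → ℕ → Carrier
  lhs k n = B n (suc k) + (b - a) * tail (k ℕ.+ 2) n

  expand-lhs : ∀ k → expand (lhs k) ≗ shift (suc k) ratio
  expand-lhs k m = begin
    expand (lhs k) m
      ≈⟨ trans (expand-+ _ _ m) (+-cong (expand-B (suc k) m) (expand-* (b - a) (tail (k ℕ.+ 2)) m)) ⟩
    δ m (suc k) + (b - a) * expand (tail (k ℕ.+ 2)) m
      ≈⟨ +-congˡ (*-congˡ (expand-tail (k ℕ.+ 2) m)) ⟩
    δ m (suc k) + (b - a) * shift (k ℕ.+ 2) (geom b) m
      ≡⟨ P.cong (λ j → δ m (suc k) + (b - a) * shift j (geom b) m) (NP.+-comm k 2) ⟩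
    δ m (suc k) + (b - a) * shift (suc (suc k)) (geom b) m
      ≈⟨ sym (shift-partialFraction a b (suc k) m) ⟩
    shift (suc k) ratio m ∎

  -- Σ_n q^{n-k} B_{n,k} z^n P_n(qz) = z^k: its coefficient of z^j is
  -- q^{j-k} times that of expand B(-,k) = z^k.
  expand-B-scaled : ∀ k j → Σ< (suc j) (λ n → (pow q (n ∸ k) * B n k) * shift n (scale q (P n)) j) ≈ δ j k
  expand-B-scaled k j = begin
    Σ< (suc j) (λ n → (pow q (n ∸ k) * B n k) * shift n (scale q (P n)) j)
      ≈⟨ Σ<-cong (suc j) collect-power ⟩
    Σ< (suc j) (λ n → pow q (j ∸ k) * (B n k * shift n (P n) j))
      ≈⟨ sym (Σ<-*ˡ (suc j) _ _) ⟩
    pow q (j ∸ k) * expand (λ n → B n k) j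
      ≈⟨ *-congˡ (expand-B k j) ⟩
    pow q (j ∸ k) * δ j k
      ≈⟨ power-at-k ⟩
    δ j k ∎
    where
    power-at-k : pow q (j ∸ k) * δ j k ≈ δ j k
    power-at-k with j NP.≟ k
    ... | yes P.refl = trans (*-congʳ (reflexive (P.cong (pow q) (NP.n∸n≡0 j)))) (*-identityˡ _)
    ... | no j≢k     = trans (*-congˡ (δ-≢ j k j≢k)) (trans (zeroʳ _) (sym (δ-≢ j k j≢k)))
    collect-power : ∀ n → n < suc j →
      (pow q (n ∸ k) * B n k) * shift n (scale q (P n)) j ≈ pow q (j ∸ k) * (B n k * shift n (P n) j)
    collect-power n n≤j with n NP.<? k
    ... | yes n<k = trans (*-congʳ (*-congˡ B≈0)) (trans (*-congʳ (zeroʳ _)) (trans (zeroˡ _)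
                      (sym (trans (*-congˡ (*-congʳ B≈0)) (trans (*-congˡ (zeroˡ _)) (zeroʳ _))))))
      where
      B≈0 : B n k ≈ 0#
      B≈0 = proj₂ isB n k n<k
    ... | no n≮k = begin
      (pow q (n ∸ k) * B n k) * shift n (scale q (P n)) j
        ≈⟨ *-congˡ (shift-scale q n (P n) j) ⟩
      (pow q (n ∸ k) * B n k) * (pow q (j ∸ n) * shift n (P n) j)
        ≈⟨ *-interchange _ _ _ _ ⟩
      (pow q (n ∸ k) * pow q (j ∸ n)) * (B n k * shift n (P n) j)
        ≈⟨ *-congʳ (sym (pow-+ q (n ∸ k) (j ∸ n))) ⟩
      pow q ((n ∸ k) ℕ.+ (j ∸ n)) * (B n k * shift n (P n) j)
        ≡⟨ P.cong (λ e → pow q e * (B n k * shift n (P n) j)) exponents ⟩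
      pow q (j ∸ k) * (B n k * shift n (P n) j) ∎
      where
      exponents : (n ∸ k) ℕ.+ (j ∸ n) ≡ j ∸ k
      exponents = P.trans (NP.+-comm (n ∸ k) (j ∸ n))
                    (P.trans (P.sym (NP.+-∸-assoc (j ∸ n) (NP.≮⇒≥ n≮k)))
                             (P.cong (_∸ k) (NP.m∸n+n≡m (NP.≤-pred n≤j))))

  -- The right side of the recurrence, shifted to be indexed by n (with value 0
  -- at n = 0); it also expands to z^{k+1} ratio.
  rhs : ℕ → ℕ → Carrier
  rhs k zero    = 0#
  rhs k (suc n) = pow q (n ∸ k) * B n k

  expand-rhs : ∀ k → expand (rhs k) ≗ shift (suc k) ratio
  expand-rhs k zero    = trans (+-identityˡ _) (zeroˡ _)
  expand-rhs k (suc m) = begin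
    expand (rhs k) (suc m)
      ≈⟨ trans (Σ<-head (suc m) _) (trans (+-congʳ (zeroˡ _)) (+-identityˡ _)) ⟩
    Σ< (suc m) (λ n → coefficient n * shift n (P (suc n)) m)
      ≈⟨ Σ<-cong (suc m) (λ n _ → *-congˡ (trans (shift-cong n (P-unfold n) m) (shift-⊛ n ratio (scale q (P n)) m))) ⟩
    Σ< (suc m) (λ n → coefficient n * (ratio ⊛ scaled n) m)
      ≈⟨ Σ-⊛-distrib ratio coefficient scaled (λ n j j<n → shift-below n _ j j<n) m ⟩
    (ratio ⊛ (λ j → Σ< (suc j) (λ n → coefficient n * scaled n j))) m
      ≈⟨ ⊛-congˡ ratio (λ j → trans (expand-B-scaled k j) (δ≈shift-one k j)) m ⟩
    (ratio ⊛ shift k one) m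
      ≈⟨ sym (shift-⊛ k ratio one m) ⟩
    shift k (ratio ⊛ one) m
      ≈⟨ shift-cong k (⊛-identityʳ ratio) m ⟩
    shift k ratio m ∎
    where
    coefficient : ℕ → Carrier
    coefficient n = pow q (n ∸ k) * B n k
    scaled : ℕ → Series
    scaled n = shift n (scale q (P n))

lemma2p1 : ∀ {c ℓ} (R : CommutativeRing c ℓ) → let open CommutativeRing R in let open QSeries R in
    (q a b : Carrier) (B : ℕ → ℕ → Carrier) → IsB q a b B →
    (k n : ℕ) → 1 ≤ n →
    B n (suc k) + (b - a) * ΣFromTo (k ℕ.+ 2) n (λ i → pow b (i ∸ (k ℕ.+ 2)) * B n i)
    ≈ pow q (n ∸ k ∸ 1) * B (n ∸ 1) k
lemma2p1 R q a b B isB k (suc n) _ = begin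
    lhs k (suc n)                   ≈⟨ expand-injective (lhs k) (rhs k) same-expansion (suc n) ⟩
    pow q (n ∸ k) * B n k           ≡⟨ P.cong (λ e → pow q e * B n k) exponent ⟩
    pow q (suc n ∸ k ∸ 1) * B n k   ∎
  where
  open CommutativeRing R
  open QSeries R
  open FormalSeries R using (_≗_)
  open Expansion R q a b B isB
  open SetoidReasoning setoid
  same-expansion : expand (lhs k) ≗ expand (rhs k)
  same-expansion m = trans (expand-lhs k m) (sym (expand-rhs k m))
  exponent : n ∸ k ≡ suc n ∸ k ∸ 1
  exponent = P.sym (P.trans (NP.∸-+-assoc (suc n) k 1) (P.cong (suc n ∸_) (NP.+-comm k 1)))
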